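{- The deterministic query complexity of finding a strong king in an $n$-vertex tournament is $\Theta(n^2)$; that is, $\mathsf{D}(\textsf{STRONG-KING}_n)=\Theta(n^2)$ for tournaments.
   Context: A tournament is a directed graph in which for every pair of distinct vertices exactly one direction of edge is present. An $n$-vertex tournament on $\{0,\dots,n-1\}$ is given as a string in $\{0,1\}^{\binom n2}$, one bit per unordered pair giving the edge direction. $\delta(u,v)$ denotes the number of directed paths of length $2$ from $u$ to $v$. A strong king is a vertex $k$ from which every vertex is reachable by a path of length at most $2$ and such that for every $w$ with $w\to k$, $\delta(k,w)>\delta(w,k)$. $\textsf{STRONG-KING}_n$ asks to output a strong king of the input tournament. $\mathsf{D}(f)$ is the minimum depth of a deterministic decision tree (adaptively querying input bits) that outputs a correct answer on every input. -}

module Defs where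

open import Data.Nat using (ℕ; zero; suc; _+_; _*_; _≤_; _<_; _⊔_)
open import Data.Bool using (Bool; true; false; not; _∧_; if_then_else_)
open import Data.Fin using (Fin)
import Data.Fin as F
open import Data.Fin.Properties using (<-cmp)
open import Data.List using (List; map; allFin)
open import Data.Nat.ListAction using (sum)
open import Data.Product using (Σ; _×_; _,_; ∃-syntax; proj₁; proj₂)
open import Data.Sum using (_⊎_)
open import Relation.Binary using (tri<; tri≈; tri>)
open import Relation.Binary.PropositionalEquality using (_≡_)

-- An unordered pair {i,j} of vertices of {0,...,n-1}, represented as i < j.
Pair : ℕ → Set
Pair n = Σ (Fin n × Fin n) (λ p → proj₁ p F.< proj₂ p)

-- An input: one bit per unordered pair (a string in {0,1}^(n choose 2)).
-- Convention: for i < j, bit true means i → j, bit false means j → i.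
Input : ℕ → Set
Input n = Pair n → Bool

arc : ∀ {n} → Input n → Fin n → Fin n → Bool
arc x u v with <-cmp u v
... | tri< p _ _ = x ((u , v) , p)
... | tri≈ _ _ _ = false
... | tri> _ _ q = not (x ((v , u) , q))

δ : ∀ {n} → Input n → Fin n → Fin n → ℕ
δ {n} x u v = sum (map (λ w → if arc x u w ∧ arc x w v then 1 else 0) (allFin n))

StrongKing : ∀ {n} → Input n → Fin n → Set
StrongKing {n} x k =
  ((v : Fin n) → (v ≡ k) ⊎ (arc x k v ≡ true)
                 ⊎ (∃[ w ] (arc x k w ≡ true × arc x w v ≡ true)))
  × ((w : Fin n) → arc x w k ≡ true → δ x w k < δ x k w)

data DTree (n : ℕ) : Set where
  leaf  : Fin n → DTree n
  query : Pair n → (ifFalse ifTrue : DTree n) → DTree n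

eval : ∀ {n} → DTree n → Input n → Fin n
eval (leaf v) x = v
eval (query q t₀ t₁) x = if x q then eval t₁ x else eval t₀ x

depth : ∀ {n} → DTree n → ℕ
depth (leaf _) = 0
depth (query _ t₀ t₁) = suc (depth t₀ ⊔ depth t₁)

SolvesStrongKing : ∀ {n} → DTree n → Set
SolvesStrongKing t = ∀ x → StrongKing x (eval t x)

-- Everything rests on an identity valid for every arc w → k:
--   score w + δ(k,w) = score k + δ(w,k) + 1,
-- obtained by comparing, for each third vertex u, the contributions of u to both sides.
-- So the strong-king inequality at an in-neighbour w of k holds iff score w ≤ score k.
--
-- Upper bound: query all pairs and output a vertex of maximum score; it is a strong king
-- (and it reaches every v → k in two steps, since δ(k,v) > δ(v,k) ≥ 0).
--
-- Lower bound: take a tournament on n vertices in which scores never increase along an arc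
-- and every in-degree is at least m ≥ n/4 (a regular tournament, plus a sink when n is even).
-- Let k be the output of a correct tree on it and u → w → k. Reversing the arc between u and w
-- raises score w by one and leaves score k unchanged, so afterwards score w > score k and k is
-- no longer a strong king: the tree must query {u, w} on this input. There are at least m²
-- such ordered pairs (u, w) and each query accounts for at most two, so the depth is at least
-- m²/2 ≥ n²/32.

module Submission where

open import Defs
open import Data.Bool using (Bool; true; false; not; _∧_; _∨_; if_then_else_)
open import Data.Bool.ListAction using (any)
open import Data.Bool.Properties using (not-involutive; ∧-comm; ∨-comm; ∨-conicalˡ; ∨-conicalʳ; if-float)
open import Data.Empty using (⊥-elim)
open import Data.Fin using (Fin; zero; suc; toℕ; combine; remQuot)
import Data.Fin as F
open import Data.Fin.Properties using (_≟_; _<?_; <-cmp; <-irrefl; <-asym; remQuot-combine)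
open import Data.List using (List; []; _∷_; length; map; mapMaybe; allFin; tabulate)
open import Data.List.Membership.Propositional using (_∈_)
open import Data.List.Membership.Propositional.Properties using (∈-allFin)
open import Data.List.Properties using (map-tabulate; length-tabulate; length-mapMaybe)
open import Data.List.Relation.Unary.All as All using (All; []; _∷_)
open import Data.List.Relation.Unary.Any as Any using (here; there)
import Data.List.Relation.Unary.Any.Properties as Anyₚ
open import Data.Maybe using (Maybe; just; nothing)
import Data.Maybe.Relation.Unary.Any as Maybe
open import Data.Nat using (ℕ; zero; suc; _+_; _*_; _≤_; _<_; _<ᵇ_; z≤n; s≤s)
import Data.Nat.ListAction as List
open import Data.Nat.Properties
  using ( +-*-semiring; ≤-totalOrder; module ≤-Reasoning
        ; ≤-refl; ≤-reflexive; ≤-trans; ≤-<-trans; <⇒≤; ≤⇒≯; 1+n≰n; m≤n⇒m≤1+n; ≤-irrelevant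
        ; suc-injective; +-suc; +-comm; +-identityʳ; +-cancelˡ-≡; +-cancelˡ-≤; +-cancelʳ-≤
        ; +-mono-≤; +-monoˡ-≤; +-monoʳ-≤; +-monoʳ-<; m≤m+n
        ; *-assoc; *-suc; *-identityˡ; *-identityʳ; *-zeroʳ; *-mono-≤; *-monoʳ-≤
        ; ⊔-idem; m≤m⊔n; m≤n⊔m )
open import Data.Nat.Tactic.RingSolver using (solve-∀)
open import Algebra.Properties.Semiring.Sum +-*-semiring
  using (sum; sum-cong-≗; sum-replicate-zero; ∑-distrib-+; *-distribˡ-sum)
open import Data.List.Extrema ≤-totalOrder using (argmax; f[xs]≤f[argmax])
open import Data.Product using (_×_; _,_; ∃-syntax; proj₂)
open import Data.Product.Properties using (≡-dec)
open import Data.Sum using (_⊎_; inj₁; inj₂)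
open import Function using (_∘_; _⇔_; mk⇔; Equivalence)
open import Relation.Binary using (tri<; tri≈; tri>; DecidableEquality)
open import Relation.Binary.PropositionalEquality
  using (_≡_; _≢_; refl; sym; trans; cong; cong₂; subst; subst₂; module ≡-Reasoning)
open import Relation.Nullary using (yes; no; does)
open import Relation.Nullary.Decidable using (dec-true; dec-false)

⟦_⟧ : Bool → ℕ
⟦ b ⟧ = if b then 1 else 0

⟦∧⟧ : ∀ a b → ⟦ a ∧ b ⟧ ≡ ⟦ a ⟧ * ⟦ b ⟧
⟦∧⟧ false b = refl
⟦∧⟧ true  b = sym (+-identityʳ ⟦ b ⟧)

⟦∨⟧-≤ : ∀ a b → ⟦ a ∨ b ⟧ ≤ ⟦ a ⟧ + ⟦ b ⟧
⟦∨⟧-≤ false b = ≤-refl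
⟦∨⟧-≤ true  b = s≤s z≤n

_≡ᵇ_ : ∀ {n} → Fin n → Fin n → Bool
i ≡ᵇ j = does (i ≟ j)

sum-mono-≤ : ∀ {n} {f g : Fin n → ℕ} → (∀ i → f i ≤ g i) → sum f ≤ sum g
sum-mono-≤ {zero}  f≤g = z≤n
sum-mono-≤ {suc n} f≤g = +-mono-≤ (f≤g zero) (sum-mono-≤ (f≤g ∘ suc))

sum-const : ∀ n c → sum {n} (λ _ → c) ≡ n * c
sum-const zero    c = refl
sum-const (suc n) c = cong (c +_) (sum-const n c)

sum-sift : ∀ {n} (j : Fin n) (f : Fin n → ℕ) → sum (λ i → ⟦ i ≡ᵇ j ⟧ * f i) ≡ f j
sum-sift {suc n} zero    f = trans (cong₂ _+_ (+-identityʳ (f zero)) (sum-replicate-zero n)) (+-identityʳ (f zero))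
sum-sift {suc n} (suc j) f = sum-sift j (λ i → f (suc i))

sum-indicator : ∀ {n} (j : Fin n) → sum (λ i → ⟦ i ≡ᵇ j ⟧) ≡ 1
sum-indicator j = trans (sum-cong-≗ (λ i → sym (*-identityʳ ⟦ i ≡ᵇ j ⟧))) (sum-sift j (λ _ → 1))

sum>0⇒∃ : ∀ {n} (f : Fin n → ℕ) → 0 < sum f → ∃[ i ] 0 < f i
sum>0⇒∃ {suc n} f 0<Σf with f zero in eq
... | suc _ = zero , subst (0 <_) (sym eq) (s≤s z≤n)
... | zero  = let i , 0<fi = sum>0⇒∃ (λ i → f (suc i)) 0<Σf in suc i , 0<fi

sum-allFin : ∀ {n} (f : Fin n → ℕ) → List.sum (map f (allFin n)) ≡ sum f
sum-allFin {n} f = trans (cong List.sum (map-tabulate (λ i → i) f)) (sum-tabulate f)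
  where
  sum-tabulate : ∀ {m} (g : Fin m → ℕ) → List.sum (tabulate g) ≡ sum g
  sum-tabulate {zero}  g = refl
  sum-tabulate {suc m} g = cong (g zero +_) (sum-tabulate (λ i → g (suc i)))

module _ {n : ℕ} (x : Input n) where

  arc-< : ∀ {u v} (u<v : u F.< v) → arc x u v ≡ x ((u , v) , u<v)
  arc-< {u} {v} u<v with <-cmp u v
  ... | tri< u<v′ _ _ = cong (λ p → x ((u , v) , p)) (≤-irrelevant u<v′ u<v)
  ... | tri≈ _ u≡v _  = ⊥-elim (<-irrefl u≡v u<v)
  ... | tri> _ _ v<u  = ⊥-elim (<-asym u<v v<u)

  arc-> : ∀ {u v} (u<v : u F.< v) → arc x v u ≡ not (x ((u , v) , u<v))
  arc-> {u} {v} u<v with <-cmp v u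
  ... | tri< v<u _ _  = ⊥-elim (<-asym u<v v<u)
  ... | tri≈ _ v≡u _  = ⊥-elim (<-irrefl (sym v≡u) u<v)
  ... | tri> _ _ u<v′ = cong (λ p → not (x ((u , v) , p))) (≤-irrelevant u<v′ u<v)

  arc-irrefl : ∀ u → arc x u u ≡ false
  arc-irrefl u with <-cmp u u
  ... | tri< u<u _ _ = ⊥-elim (<-irrefl refl u<u)
  ... | tri≈ _ _ _   = refl
  ... | tri> _ _ u<u = ⊥-elim (<-irrefl refl u<u)

  arc-converse : ∀ {u v} → u ≢ v → arc x v u ≡ not (arc x u v)
  arc-converse {u} {v} u≢v with <-cmp u v
  ... | tri< u<v _ _ = arc-> u<v
  ... | tri≈ _ u≡v _ = ⊥-elim (u≢v u≡v)
  ... | tri> _ _ v<u = trans (arc-< v<u) (sym (not-involutive _))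

  arc⇒≢ : ∀ u v → arc x u v ≡ true → u ≢ v
  arc⇒≢ u _ u→v refl with () ← trans (sym u→v) (arc-irrefl u)

  arc-asym : ∀ u v → arc x u v ≡ true → arc x v u ≡ false
  arc-asym u v u→v = trans (arc-converse (arc⇒≢ u v u→v)) (cong not u→v)

  score : Fin n → ℕ
  score v = sum λ u → ⟦ arc x v u ⟧

  inDegree : Fin n → ℕ
  inDegree v = sum λ u → ⟦ arc x u v ⟧

  δ≡sum : ∀ u v → δ x u v ≡ sum (λ w → ⟦ arc x u w ∧ arc x w v ⟧)
  δ≡sum u v = sum-allFin (λ w → ⟦ arc x u w ∧ arc x w v ⟧)

  score+inDegree : ∀ v → suc (score v + inDegree v) ≡ n
  score+inDegree v = begin
    suc (score v + inDegree v)
      ≡⟨ +-comm 1 _ ⟩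
    score v + inDegree v + 1
      ≡⟨ cong (score v + inDegree v +_) (sum-indicator v) ⟨
    score v + inDegree v + sum (λ u → ⟦ u ≡ᵇ v ⟧)
      ≡⟨ cong (_+ sum (λ u → ⟦ u ≡ᵇ v ⟧)) (∑-distrib-+ (λ u → ⟦ arc x v u ⟧) _) ⟨
    sum (λ u → ⟦ arc x v u ⟧ + ⟦ arc x u v ⟧) + sum (λ u → ⟦ u ≡ᵇ v ⟧)
      ≡⟨ ∑-distrib-+ (λ u → ⟦ arc x v u ⟧ + ⟦ arc x u v ⟧) _ ⟨
    sum (λ u → ⟦ arc x v u ⟧ + ⟦ arc x u v ⟧ + ⟦ u ≡ᵇ v ⟧)
      ≡⟨ sum-cong-≗ one-arc-or-equal ⟩
    sum {n} (λ _ → 1)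
      ≡⟨ sum-const n 1 ⟩
    n * 1
      ≡⟨ *-identityʳ n ⟩
    n
      ∎
    where
    open ≡-Reasoning
    one-arc-or-equal : ∀ u → ⟦ arc x v u ⟧ + ⟦ arc x u v ⟧ + ⟦ u ≡ᵇ v ⟧ ≡ 1
    one-arc-or-equal u with u ≟ v
    ... | yes refl rewrite arc-irrefl u = refl
    ... | no u≢v rewrite arc-converse {v} {u} (u≢v ∘ sym) with arc x v u
    ...   | true  = refl
    ...   | false = refl

  score-δ-balance : ∀ w k → arc x w k ≡ true → score w + δ x k w ≡ suc (score k + δ x w k)
  score-δ-balance w k w→k = begin
    score w + δ x k w
      ≡⟨ cong (score w +_) (δ≡sum k w) ⟩
    score w + sum (λ u → ⟦ arc x k u ∧ arc x u w ⟧)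
      ≡⟨ ∑-distrib-+ (λ u → ⟦ arc x w u ⟧) _ ⟨
    sum (λ u → ⟦ arc x w u ⟧ + ⟦ arc x k u ∧ arc x u w ⟧)
      ≡⟨ sum-cong-≗ pointwise ⟩
    sum (λ u → ⟦ arc x k u ⟧ + ⟦ arc x w u ∧ arc x u k ⟧ + ⟦ u ≡ᵇ k ⟧)
      ≡⟨ ∑-distrib-+ (λ u → ⟦ arc x k u ⟧ + ⟦ arc x w u ∧ arc x u k ⟧) _ ⟩
    sum (λ u → ⟦ arc x k u ⟧ + ⟦ arc x w u ∧ arc x u k ⟧) + sum (λ u → ⟦ u ≡ᵇ k ⟧)
      ≡⟨ cong₂ _+_ (∑-distrib-+ (λ u → ⟦ arc x k u ⟧) _) (sum-indicator k) ⟩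
    score k + sum (λ u → ⟦ arc x w u ∧ arc x u k ⟧) + 1
      ≡⟨ cong (λ d → score k + d + 1) (δ≡sum w k) ⟨
    score k + δ x w k + 1
      ≡⟨ +-comm _ 1 ⟩
    suc (score k + δ x w k)
      ∎
    where
    open ≡-Reasoning
    swap : ∀ a b → ⟦ a ⟧ + ⟦ b ∧ not a ⟧ ≡ ⟦ b ⟧ + ⟦ a ∧ not b ⟧ + 0
    swap false false = refl
    swap false true  = refl
    swap true  false = refl
    swap true  true  = refl
    pointwise : ∀ u → ⟦ arc x w u ⟧ + ⟦ arc x k u ∧ arc x u w ⟧
                    ≡ ⟦ arc x k u ⟧ + ⟦ arc x w u ∧ arc x u k ⟧ + ⟦ u ≡ᵇ k ⟧
    pointwise u with u ≟ k | u ≟ w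
    ... | yes refl | _        rewrite w→k | arc-irrefl u = refl
    ... | no _     | yes refl rewrite arc-irrefl u | arc-asym u k w→k = refl
    ... | no u≢k   | no u≢w   rewrite arc-converse {w} {u} (u≢w ∘ sym) | arc-converse {k} {u} (u≢k ∘ sym)
      = swap (arc x w u) (arc x k u)

  δ<δ⇔score≤score : ∀ w k → arc x w k ≡ true → (δ x w k < δ x k w) ⇔ (score w ≤ score k)
  δ<δ⇔score≤score w k w→k = mk⇔ to from
    where
    open ≤-Reasoning
    to : δ x w k < δ x k w → score w ≤ score k
    to δwk<δkw = +-cancelʳ-≤ (δ x k w) (score w) (score k) (begin
      score w + δ x k w          ≡⟨ score-δ-balance w k w→k ⟩
      suc (score k + δ x w k)    ≡⟨ +-suc (score k) _ ⟨
      score k + suc (δ x w k)    ≤⟨ +-monoʳ-≤ (score k) δwk<δkw ⟩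
      score k + δ x k w          ∎)
    from : score w ≤ score k → δ x w k < δ x k w
    from sw≤sk = +-cancelˡ-≤ (score k) (suc (δ x w k)) (δ x k w) (begin
      score k + suc (δ x w k)    ≡⟨ +-suc (score k) _ ⟩
      suc (score k + δ x w k)    ≡⟨ score-δ-balance w k w→k ⟨
      score w + δ x k w          ≤⟨ +-monoˡ-≤ (δ x k w) sw≤sk ⟩
      score k + δ x k w          ∎)

  maxScore⇒StrongKing : ∀ {k} → (∀ v → score v ≤ score k) → StrongKing x k
  maxScore⇒StrongKing {k} maximal = reach , beats
    where
    beats : ∀ w → arc x w k ≡ true → δ x w k < δ x k w
    beats w w→k = Equivalence.from (δ<δ⇔score≤score w k w→k) (maximal w)
    twoStep : ∀ v → arc x v k ≡ true → ∃[ w ] (arc x k w ≡ true × arc x w v ≡ true)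
    twoStep v v→k with sum>0⇒∃ (λ w → ⟦ arc x k w ∧ arc x w v ⟧)
                                 (subst (0 <_) (δ≡sum k v) (≤-<-trans z≤n (beats v v→k)))
    ... | w , 0<path with arc x k w in k→w | arc x w v in w→v
    ...   | true | true = w , k→w , w→v
    reach : ∀ v → v ≡ k ⊎ arc x k v ≡ true ⊎ ∃[ w ] (arc x k w ≡ true × arc x w v ≡ true)
    reach v with v ≟ k
    ... | yes v≡k = inj₁ v≡k
    ... | no v≢k with arc x k v in k→v
    ...   | true  = inj₂ (inj₁ refl)
    ...   | false = inj₂ (inj₂ (twoStep v (trans (arc-converse (v≢k ∘ sym)) (cong not k→v))))

module _ {n : ℕ} where

  _≟ᴾ_ : DecidableEquality (Pair n)
  _≟ᴾ_ = ≡-dec (≡-dec _≟_ _≟_) (λ p q → yes (≤-irrelevant p q))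

  _[_≔_] : Input n → Pair n → Bool → Input n
  (y [ p ≔ b ]) q = if does (q ≟ᴾ p) then b else y q

  readAll : List (Pair n) → (Input n → Fin n) → DTree n
  readAll []       g = leaf (g (λ _ → false))
  readAll (p ∷ ps) g = query p (readAll ps (λ y → g (y [ p ≔ false ])))
                               (readAll ps (λ y → g (y [ p ≔ true ])))

  restrict : List (Pair n) → Input n → Input n
  restrict []       x = λ _ → false
  restrict (p ∷ ps) x = restrict ps x [ p ≔ x p ]

  eval-readAll : ∀ ps g x → eval (readAll ps g) x ≡ g (restrict ps x)
  eval-readAll []       g x = refl
  eval-readAll (p ∷ ps) g x with x p
  ... | false = eval-readAll ps (λ y → g (y [ p ≔ false ])) x
  ... | true  = eval-readAll ps (λ y → g (y [ p ≔ true ])) x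

  depth-readAll : ∀ ps g → depth (readAll ps g) ≡ length ps
  depth-readAll []       g = refl
  depth-readAll (p ∷ ps) g
    rewrite depth-readAll ps (λ y → g (y [ p ≔ false ]))
          | depth-readAll ps (λ y → g (y [ p ≔ true ])) = cong suc (⊔-idem (length ps))

  restrict-∈ : ∀ {ps q} x → q ∈ ps → restrict ps x q ≡ x q
  restrict-∈ {p ∷ ps} {q} x q∈ with q ≟ᴾ p | q∈
  ... | yes refl | _          = refl
  ... | no q≢p   | here q≡p   = ⊥-elim (q≢p q≡p)
  ... | no _     | there q∈ps = restrict-∈ x q∈ps

toPair : ∀ {n} → Fin n × Fin n → Maybe (Pair n)
toPair (i , j) with i <? j
... | yes i<j = just ((i , j) , i<j)
... | no _    = nothing

toPair-< : ∀ {n} {i j : Fin n} (i<j : i F.< j) → toPair (i , j) ≡ just ((i , j) , i<j)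
toPair-< {i = i} {j} i<j with i <? j
... | yes i<j′ = cong (λ p → just ((i , j) , p)) (≤-irrelevant i<j′ i<j)
... | no i≮j   = ⊥-elim (i≮j i<j)

allPairs : ∀ n → List (Pair n)
allPairs n = mapMaybe (toPair ∘ remQuot n) (allFin (n * n))

length-allPairs : ∀ n → length (allPairs n) ≤ n * n
length-allPairs n = ≤-trans (length-mapMaybe (toPair ∘ remQuot n) (allFin (n * n)))
                            (≤-reflexive (length-tabulate (λ i → i)))

∈-allPairs : ∀ {n} (q : Pair n) → q ∈ allPairs n
∈-allPairs {n} q@((i , j) , i<j) =
  Anyₚ.mapMaybe⁺ (toPair ∘ remQuot n) (allFin (n * n))
    (Anyₚ.map⁺ (Any.map (λ { refl → subst (Maybe.Any (q ≡_)) (sym toPair-combine) (Maybe.just refl) })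
                       (∈-allFin (combine i j))))
  where
  toPair-combine : toPair (remQuot n (combine i j)) ≡ just q
  toPair-combine = trans (cong toPair (remQuot-combine i j)) (toPair-< i<j)

arc-cong : ∀ {n} {x y : Input n} → (∀ q → y q ≡ x q) → ∀ u v → arc y u v ≡ arc x u v
arc-cong y≗x u v with <-cmp u v
... | tri< u<v _ _ = y≗x ((u , v) , u<v)
... | tri≈ _ _ _   = refl
... | tri> _ _ v<u = cong not (y≗x ((v , u) , v<u))

score-cong : ∀ {n} {x y : Input n} → (∀ q → y q ≡ x q) → ∀ v → score y v ≡ score x v
score-cong y≗x v = sum-cong-≗ (λ u → cong ⟦_⟧ (arc-cong y≗x v u))

readAllPairs-solves : ∀ {n} (g : Input n → Fin n) →
                      (∀ x y → (∀ q → y q ≡ x q) → StrongKing x (g y)) →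
                      SolvesStrongKing (readAll (allPairs n) g)
readAllPairs-solves {n} g king x =
  subst (StrongKing x) (sym (eval-readAll (allPairs n) g x))
        (king x (restrict (allPairs n) x) (λ q → restrict-∈ x (∈-allPairs q)))

upperBound : ∀ n → 1 ≤ n → ∃[ t ] (SolvesStrongKing {n} t × depth t ≤ n * n)
upperBound n@(suc _) _ = readAll (allPairs n) maxScoreVertex , readAllPairs-solves maxScoreVertex king , depth≤
  where
  maxScoreVertex : Input n → Fin n
  maxScoreVertex y = argmax (score y) zero (allFin n)

  king : ∀ x y → (∀ q → y q ≡ x q) → StrongKing x (maxScoreVertex y)
  king x y y≗x = maxScore⇒StrongKing x {maxScoreVertex y} λ v →
    subst₂ _≤_ (score-cong y≗x v) (score-cong y≗x (maxScoreVertex y))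
               (All.lookup (f[xs]≤f[argmax] {f = score y} zero (allFin n)) (∈-allFin v))

  depth≤ : depth (readAll (allPairs n) maxScoreVertex) ≤ n * n
  depth≤ = subst (_≤ n * n) (sym (depth-readAll (allPairs n) maxScoreVertex)) (length-allPairs n)

module _ {n : ℕ} where

  path : DTree n → Input n → List (Pair n)
  path (leaf _)        x = []
  path (query p t₀ t₁) x = p ∷ (if x p then path t₁ x else path t₀ x)

  length-path≤depth : ∀ t x → length (path t x) ≤ depth t
  length-path≤depth (leaf _)        x = z≤n
  length-path≤depth (query p t₀ t₁) x with x p
  ... | false = s≤s (≤-trans (length-path≤depth t₀ x) (m≤m⊔n (depth t₀) (depth t₁)))
  ... | true  = s≤s (≤-trans (length-path≤depth t₁ x) (m≤n⊔m (depth t₀) (depth t₁)))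

  eval-agree : ∀ t x y → All (λ p → y p ≡ x p) (path t x) → eval t y ≡ eval t x
  eval-agree (leaf _)        x y []               = refl
  eval-agree (query p t₀ t₁) x y (yp≡xp ∷ agree) rewrite yp≡xp with x p
  ... | false = eval-agree t₀ x y agree
  ... | true  = eval-agree t₁ x y agree

  sameEdge : Fin n → Fin n → Fin n → Fin n → Bool
  sameEdge a b u w = (u ≡ᵇ a ∧ w ≡ᵇ b) ∨ (w ≡ᵇ a ∧ u ≡ᵇ b)

  sameEdge-sym : ∀ a b u w → sameEdge b a u w ≡ sameEdge a b u w
  sameEdge-sym a b u w =
    trans (∨-comm (u ≡ᵇ b ∧ w ≡ᵇ a) _) (cong₂ _∨_ (∧-comm (w ≡ᵇ b) _) (∧-comm (u ≡ᵇ b) _))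

  links : Pair n → Fin n → Fin n → Bool
  links ((a , b) , _) = sameEdge a b

  reverse : Fin n → Fin n → Input n → Input n
  reverse u w x p = if links p u w then not (x p) else x p

  arc-reverse : ∀ u w x {a b} → a ≢ b →
                arc (reverse u w x) a b ≡ (if sameEdge a b u w then not (arc x a b) else arc x a b)
  arc-reverse u w x {a} {b} a≢b with <-cmp a b
  ... | tri< _ _ _   = refl
  ... | tri≈ _ a≡b _ = ⊥-elim (a≢b a≡b)
  ... | tri> _ _ _   rewrite sameEdge-sym a b u w = if-float not (sameEdge a b u w)

  reverse-agrees : ∀ u w x ps → any (λ p → links p u w) ps ≡ false → All (λ p → reverse u w x p ≡ x p) ps
  reverse-agrees u w x []       _ = []
  reverse-agrees u w x (p ∷ ps) untouched =
    cong (λ b → if b then not (x p) else x p) (∨-conicalˡ (links p u w) _ untouched)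
      ∷ reverse-agrees u w x ps (∨-conicalʳ (links p u w) _ untouched)

module _ {n : ℕ} (x : Input n) (u w : Fin n) (u→w : arc x u w ≡ true) where

  private
    x′ = reverse u w x
    u≢w = arc⇒≢ x u w u→w

  arc-reverse-other : ∀ {a b} → sameEdge a b u w ≡ false → arc x′ a b ≡ arc x a b
  arc-reverse-other {a} {b} other with a ≟ b
  ... | yes refl = trans (arc-irrefl x′ a) (sym (arc-irrefl x a))
  ... | no a≢b   = trans (arc-reverse u w x a≢b) (cong (λ s → if s then not (arc x a b) else arc x a b) other)

  arc-reverse-reversed : arc x′ w u ≡ true
  arc-reverse-reversed = begin
    arc x′ w u
      ≡⟨ arc-reverse u w x (u≢w ∘ sym) ⟩
    (if sameEdge w u u w then not (arc x w u) else arc x w u)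
      ≡⟨ cong (λ s → if s then not (arc x w u) else arc x w u) same ⟩
    not (arc x w u)
      ≡⟨ cong not (arc-asym x u w u→w) ⟩
    true
      ∎
    where
    open ≡-Reasoning
    same : sameEdge w u u w ≡ true
    same rewrite dec-false (u ≟ w) u≢w | dec-true (w ≟ w) refl | dec-true (u ≟ u) refl = refl

  score-reverse-other : ∀ {k} → u ≢ k → w ≢ k → score x′ k ≡ score x k
  score-reverse-other {k} u≢k w≢k = sum-cong-≗ (λ v → cong ⟦_⟧ (arc-reverse-other (other v)))
    where
    other : ∀ v → sameEdge k v u w ≡ false
    other v rewrite dec-false (u ≟ k) u≢k | dec-false (w ≟ k) w≢k = refl

  score-reverse-target : score x′ w ≡ suc (score x w)
  score-reverse-target = begin
    score x′ w                                 ≡⟨ sum-cong-≗ pointwise ⟩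
    sum (λ v → ⟦ arc x w v ⟧ + ⟦ v ≡ᵇ u ⟧)     ≡⟨ ∑-distrib-+ (λ v → ⟦ arc x w v ⟧) _ ⟩
    score x w + sum (λ v → ⟦ v ≡ᵇ u ⟧)         ≡⟨ cong (score x w +_) (sum-indicator u) ⟩
    score x w + 1                              ≡⟨ +-comm _ 1 ⟩
    suc (score x w)                            ∎
    where
    open ≡-Reasoning
    other : ∀ {v} → v ≢ u → sameEdge w v u w ≡ false
    other {v} v≢u rewrite dec-false (u ≟ w) u≢w | dec-true (w ≟ w) refl | dec-false (u ≟ v) (v≢u ∘ sym) = refl
    pointwise : ∀ v → ⟦ arc x′ w v ⟧ ≡ ⟦ arc x w v ⟧ + ⟦ v ≡ᵇ u ⟧
    pointwise v with v ≟ u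
    ... | yes refl = trans (cong ⟦_⟧ arc-reverse-reversed) (cong (λ b → ⟦ b ⟧ + 1) (sym (arc-asym x u w u→w)))
    ... | no v≢u   = trans (cong ⟦_⟧ (arc-reverse-other (other v≢u))) (sym (+-identityʳ _))

  arc-reverse-target : ∀ {k} → u ≢ k → arc x w k ≡ true → arc x′ w k ≡ true
  arc-reverse-target {k} u≢k w→k = trans (arc-reverse-other other) w→k
    where
    other : sameEdge w k u w ≡ false
    other rewrite dec-false (u ≟ w) u≢w | dec-true (w ≟ w) refl | dec-false (u ≟ k) u≢k = refl

sum-sameEdge≤2 : ∀ {n} (a b : Fin n) → sum (λ w → sum (λ u → ⟦ sameEdge a b u w ⟧)) ≤ 2
sum-sameEdge≤2 {n} a b = begin
  sum (λ w → sum (λ u → ⟦ sameEdge a b u w ⟧))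
    ≤⟨ sum-mono-≤ (λ w → sum-mono-≤ (λ u → split (u ≡ᵇ a) (w ≡ᵇ b) (w ≡ᵇ a) (u ≡ᵇ b))) ⟩
  sum (λ w → sum (λ u → ⟦ u ≡ᵇ a ⟧ * ⟦ w ≡ᵇ b ⟧ + ⟦ u ≡ᵇ b ⟧ * ⟦ w ≡ᵇ a ⟧))
    ≡⟨ sum-cong-≗ (λ w → trans (∑-distrib-+ (λ u → ⟦ u ≡ᵇ a ⟧ * ⟦ w ≡ᵇ b ⟧) _)
                               (cong₂ _+_ (sum-sift a (λ _ → ⟦ w ≡ᵇ b ⟧)) (sum-sift b (λ _ → ⟦ w ≡ᵇ a ⟧)))) ⟩
  sum (λ w → ⟦ w ≡ᵇ b ⟧ + ⟦ w ≡ᵇ a ⟧)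
    ≡⟨ ∑-distrib-+ (λ w → ⟦ w ≡ᵇ b ⟧) _ ⟩
  sum (λ w → ⟦ w ≡ᵇ b ⟧) + sum (λ w → ⟦ w ≡ᵇ a ⟧)
    ≡⟨ cong₂ _+_ (sum-indicator b) (sum-indicator a) ⟩
  2 ∎
  where
  open ≤-Reasoning
  split : ∀ p q r s → ⟦ (p ∧ q) ∨ (r ∧ s) ⟧ ≤ ⟦ p ⟧ * ⟦ q ⟧ + ⟦ s ⟧ * ⟦ r ⟧
  split p q r s = ≤-trans (⟦∨⟧-≤ (p ∧ q) (r ∧ s))
                          (≤-reflexive (cong₂ _+_ (⟦∧⟧ p q) (trans (cong ⟦_⟧ (∧-comm r s)) (⟦∧⟧ s r))))

touched : ∀ {n} → Fin n → Fin n → List (Pair n) → Bool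
touched u w = any (λ p → links p u w)

sum-touched≤ : ∀ {n} (ps : List (Pair n)) → sum (λ w → sum (λ u → ⟦ touched u w ps ⟧)) ≤ 2 * length ps
sum-touched≤ {n} [] = ≤-reflexive (trans (sum-cong-≗ {n} (λ _ → sum-replicate-zero n)) (sum-replicate-zero n))
sum-touched≤ {n} (p@((a , b) , _) ∷ ps) = begin
  sum (λ w → sum (λ u → ⟦ links p u w ∨ touched u w ps ⟧))
    ≤⟨ sum-mono-≤ (λ w → sum-mono-≤ (λ u → ⟦∨⟧-≤ (links p u w) (touched u w ps))) ⟩
  sum (λ w → sum (λ u → ⟦ links p u w ⟧ + ⟦ touched u w ps ⟧))
    ≡⟨ sum-cong-≗ (λ w → ∑-distrib-+ (λ u → ⟦ links p u w ⟧) _) ⟩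
  sum (λ w → sum (λ u → ⟦ links p u w ⟧) + sum (λ u → ⟦ touched u w ps ⟧))
    ≡⟨ ∑-distrib-+ (λ w → sum (λ u → ⟦ links p u w ⟧)) _ ⟩
  sum (λ w → sum (λ u → ⟦ links p u w ⟧)) + sum (λ w → sum (λ u → ⟦ touched u w ps ⟧))
    ≤⟨ +-mono-≤ (sum-sameEdge≤2 a b) (sum-touched≤ ps) ⟩
  2 + 2 * length ps
    ≡⟨ *-suc 2 (length ps) ⟨
  2 * length (p ∷ ps) ∎
  where open ≤-Reasoning

record HardInstance (n m : ℕ) : Set where
  field
    input          : Input n
    score-antitone : ∀ a b → arc input a b ≡ true → score input b ≤ score input a
    inDegree-≥     : ∀ v → m ≤ inDegree input v

module _ {n m : ℕ} (H : HardInstance n m) (t : DTree n) (solves : SolvesStrongKing t) where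

  open HardInstance H renaming (input to x)

  private
    k = eval t x

  path-touches-arc-into-in-neighbour : ∀ u w → arc x u w ≡ true → arc x w k ≡ true →
                                       touched u w (path t x) ≡ true
  path-touches-arc-into-in-neighbour u w u→w w→k with touched u w (path t x) in untouched
  ... | true  = refl
  ... | false = ⊥-elim (1+n≰n (begin
    suc (score x w)         ≡⟨ score-reverse-target x u w u→w ⟨
    score x′ w              ≤⟨ Equivalence.to (δ<δ⇔score≤score x′ w k w→′k) (proj₂ king w w→′k) ⟩
    score x′ k              ≡⟨ score-reverse-other x u w u→w u≢k (arc⇒≢ x w k w→k) ⟩
    score x k               ≤⟨ score-antitone w k w→k ⟩
    score x w               ∎))
    where
    open ≤-Reasoning
    x′ = reverse u w x
    u≢k : u ≢ k
    u≢k refl with () ← trans (sym u→w) (arc-asym x w k w→k)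
    w→′k : arc x′ w k ≡ true
    w→′k = arc-reverse-target x u w u→w u≢k w→k
    king : StrongKing x′ k
    king = subst (StrongKing x′) (eval-agree t x x′ (reverse-agrees u w x (path t x) untouched)) (solves x′)

  depth-lowerBound : m * m ≤ 2 * depth t
  depth-lowerBound = begin
    m * m
      ≤⟨ *-monoʳ-≤ m (inDegree-≥ k) ⟩
    m * inDegree x k
      ≡⟨ *-distribˡ-sum m (λ w → ⟦ arc x w k ⟧) ⟩
    sum (λ w → m * ⟦ arc x w k ⟧)
      ≤⟨ sum-mono-≤ (λ w → m*⟦b⟧≤⟦b⟧*i (arc x w k) (λ _ → inDegree-≥ w)) ⟩
    sum (λ w → ⟦ arc x w k ⟧ * inDegree x w)
      ≡⟨ sum-cong-≗ (λ w → *-distribˡ-sum ⟦ arc x w k ⟧ (λ u → ⟦ arc x u w ⟧)) ⟩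
    sum (λ w → sum (λ u → ⟦ arc x w k ⟧ * ⟦ arc x u w ⟧))
      ≤⟨ sum-mono-≤ (λ w → sum-mono-≤ (λ u → ⟦a⟧*⟦b⟧≤⟦c⟧ (arc x w k) (arc x u w) _
                        (λ w→k u→w → path-touches-arc-into-in-neighbour u w u→w w→k))) ⟩
    sum (λ w → sum (λ u → ⟦ touched u w (path t x) ⟧))
      ≤⟨ sum-touched≤ (path t x) ⟩
    2 * length (path t x)
      ≤⟨ *-monoʳ-≤ 2 (length-path≤depth t x) ⟩
    2 * depth t
      ∎
    where
    open ≤-Reasoning
    m*⟦b⟧≤⟦b⟧*i : ∀ b {i} → (b ≡ true → m ≤ i) → m * ⟦ b ⟧ ≤ ⟦ b ⟧ * i
    m*⟦b⟧≤⟦b⟧*i false _   = ≤-reflexive (*-zeroʳ m)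
    m*⟦b⟧≤⟦b⟧*i true  m≤i = subst₂ _≤_ (sym (*-identityʳ m)) (sym (+-identityʳ _)) (m≤i refl)
    ⟦a⟧*⟦b⟧≤⟦c⟧ : ∀ a b c → (a ≡ true → b ≡ true → c ≡ true) → ⟦ a ⟧ * ⟦ b ⟧ ≤ ⟦ c ⟧
    ⟦a⟧*⟦b⟧≤⟦c⟧ true  true  c a∧b⇒c rewrite a∧b⇒c refl refl = ≤-refl
    ⟦a⟧*⟦b⟧≤⟦c⟧ true  false c _ = z≤n
    ⟦a⟧*⟦b⟧≤⟦c⟧ false b     c _ = z≤n

fromArcs : ∀ {n} → (Fin n → Fin n → Bool) → Input n
fromArcs A ((a , b) , _) = A a b

arc-fromArcs : ∀ {n} {A : Fin n → Fin n → Bool} →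
               (∀ u → A u u ≡ false) → (∀ {u v} → u ≢ v → A v u ≡ not (A u v)) →
               ∀ a b → arc (fromArcs A) a b ≡ A a b
arc-fromArcs irrefl converse a b with <-cmp a b
... | tri< _ _ _    = refl
... | tri≈ _ refl _ = sym (irrefl a)
... | tri> _ _ b<a  = sym (converse λ b≡a → <-irrefl b≡a b<a)

1+2*_ : ℕ → ℕ
1+2* zero  = 1
1+2* suc m = suc (suc (1+2* m))

1+2*≡ : ∀ m → 1+2* m ≡ suc (m + m)
1+2*≡ zero    = refl
1+2*≡ (suc m) = cong (2 +_) (trans (1+2*≡ m) (sym (+-suc m m)))

m≤1+2*m : ∀ m → m ≤ 1+2* m
m≤1+2*m m = subst (m ≤_) (sym (1+2*≡ m)) (m≤n⇒m≤1+n (m≤m+n m m))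

count-< : ∀ K m → m ≤ K → sum {K} (λ v → ⟦ toℕ v <ᵇ m ⟧) ≡ m
count-< zero    zero    _         = refl
count-< (suc K) zero    _         = sum-replicate-zero K
count-< (suc K) (suc m) (s≤s m≤K) = cong suc (count-< K m m≤K)

count-≮ : ∀ m → sum {1+2* m} (λ v → ⟦ not (toℕ v <ᵇ m) ⟧) ≡ suc m
count-≮ m = +-cancelˡ-≡ m _ _ (begin
  m + sum high                ≡⟨ cong (_+ sum high) (count-< (1+2* m) m (m≤1+2*m m)) ⟨
  sum low + sum high          ≡⟨ ∑-distrib-+ low high ⟨
  sum (λ v → low v + high v)  ≡⟨ sum-cong-≗ {1+2* m} (λ v → one (toℕ v <ᵇ m)) ⟩
  sum {1+2* m} (λ _ → 1)      ≡⟨ sum-const (1+2* m) 1 ⟩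
  (1+2* m) * 1                ≡⟨ *-identityʳ (1+2* m) ⟩
  1+2* m                      ≡⟨ 1+2*≡ m ⟩
  suc (m + m)                 ≡⟨ +-suc m m ⟨
  m + suc m                   ∎)
  where
  open ≡-Reasoning
  low high : Fin (1+2* m) → ℕ
  low  v = ⟦ toℕ v <ᵇ m ⟧
  high v = ⟦ not (toℕ v <ᵇ m) ⟧
  one : ∀ b → ⟦ b ⟧ + ⟦ not b ⟧ ≡ 1
  one false = refl
  one true  = refl

-- Built from the regular tournament on 1+2*m vertices (shifted by two) by adding vertices 0 and 1:
-- 0 → 1, 0 beats the old vertices of index < m and 1 beats the others, so that every old
-- vertex gains exactly one win and 0 and 1 end up with m + 1 wins too.
regular : ∀ m → Fin (1+2* m) → Fin (1+2* m) → Bool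
regular zero    _             _             = false
regular (suc m) zero          zero          = false
regular (suc m) zero          (suc zero)    = true
regular (suc m) zero          (suc (suc v)) = toℕ v <ᵇ m
regular (suc m) (suc zero)    zero          = false
regular (suc m) (suc zero)    (suc zero)    = false
regular (suc m) (suc zero)    (suc (suc v)) = not (toℕ v <ᵇ m)
regular (suc m) (suc (suc u)) zero          = not (toℕ u <ᵇ m)
regular (suc m) (suc (suc u)) (suc zero)    = toℕ u <ᵇ m
regular (suc m) (suc (suc u)) (suc (suc v)) = regular m u v

regular-irrefl : ∀ m u → regular m u u ≡ false
regular-irrefl zero    zero          = refl
regular-irrefl (suc m) zero          = refl
regular-irrefl (suc m) (suc zero)    = refl
regular-irrefl (suc m) (suc (suc u)) = regular-irrefl m u

regular-converse : ∀ m {u v} → u ≢ v → regular m v u ≡ not (regular m u v)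
regular-converse zero    {zero}        {zero}        u≢v = ⊥-elim (u≢v refl)
regular-converse (suc m) {zero}        {zero}        u≢v = ⊥-elim (u≢v refl)
regular-converse (suc m) {zero}        {suc zero}    _   = refl
regular-converse (suc m) {zero}        {suc (suc v)} _   = refl
regular-converse (suc m) {suc zero}    {zero}        _   = refl
regular-converse (suc m) {suc zero}    {suc zero}    u≢v = ⊥-elim (u≢v refl)
regular-converse (suc m) {suc zero}    {suc (suc v)} _   = sym (not-involutive _)
regular-converse (suc m) {suc (suc u)} {zero}        _   = sym (not-involutive _)
regular-converse (suc m) {suc (suc u)} {suc zero}    _   = refl
regular-converse (suc m) {suc (suc u)} {suc (suc v)} u≢v = regular-converse m (u≢v ∘ cong (λ i → suc (suc i)))

regular-outDegree : ∀ m u → sum (λ v → ⟦ regular m u v ⟧) ≡ m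
regular-outDegree zero    zero          = refl
regular-outDegree (suc m) zero          = cong suc (count-< (1+2* m) m (m≤1+2*m m))
regular-outDegree (suc m) (suc zero)    = count-≮ m
regular-outDegree (suc m) (suc (suc u)) =
  trans (cong (λ d → ⟦ not (toℕ u <ᵇ m) ⟧ + (⟦ toℕ u <ᵇ m ⟧ + d)) (regular-outDegree m u))
        (one-of (toℕ u <ᵇ m))
  where
  one-of : ∀ b → ⟦ not b ⟧ + (⟦ b ⟧ + m) ≡ suc m
  one-of false = refl
  one-of true  = refl

regularInstance : ∀ m → HardInstance (1+2* m) m
regularInstance m = record
  { input          = x
  ; score-antitone = λ a b _ → ≤-reflexive (trans (score≡m b) (sym (score≡m a)))
  ; inDegree-≥     = λ v → ≤-reflexive (sym (inDegree≡m v))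
  }
  where
  x = fromArcs (regular m)
  score≡m : ∀ v → score x v ≡ m
  score≡m v = trans (sum-cong-≗ (λ u → cong ⟦_⟧ (arc-fromArcs (regular-irrefl m) (regular-converse m) v u)))
                    (regular-outDegree m v)
  inDegree≡m : ∀ v → inDegree x v ≡ m
  inDegree≡m v = +-cancelˡ-≡ m _ _ (suc-injective (begin
    suc (m + inDegree x v)          ≡⟨ cong (λ s → suc (s + inDegree x v)) (score≡m v) ⟨
    suc (score x v + inDegree x v)  ≡⟨ score+inDegree x v ⟩
    1+2* m                          ≡⟨ 1+2*≡ m ⟩
    suc (m + m)                     ∎))
    where open ≡-Reasoning

withSink : ∀ {n} → (Fin n → Fin n → Bool) → Fin (suc n) → Fin (suc n) → Bool
withSink A zero    _       = false
withSink A (suc u) zero    = true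
withSink A (suc u) (suc v) = A u v

sinkInstance : ∀ {n m} → m ≤ n → HardInstance n m → HardInstance (suc n) m
sinkInstance {n} {m} m≤n H = record
  { input          = x′
  ; score-antitone = antitone
  ; inDegree-≥     = inDegree-≥′
  }
  where
  open HardInstance H renaming (input to x)
  x′ = fromArcs (withSink (arc x))

  arc′ : ∀ a b → arc x′ a b ≡ withSink (arc x) a b
  arc′ = arc-fromArcs irrefl converse
    where
    irrefl : ∀ u → withSink (arc x) u u ≡ false
    irrefl zero    = refl
    irrefl (suc u) = arc-irrefl x u
    converse : ∀ {u v} → u ≢ v → withSink (arc x) v u ≡ not (withSink (arc x) u v)
    converse {zero}  {zero}  u≢v = ⊥-elim (u≢v refl)
    converse {zero}  {suc v} _   = refl
    converse {suc u} {zero}  _   = refl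
    converse {suc u} {suc v} u≢v = arc-converse x (u≢v ∘ cong suc)

  score-sink : score x′ zero ≡ 0
  score-sink = trans (sum-cong-≗ (λ v → cong ⟦_⟧ (arc′ zero v))) (sum-replicate-zero (suc n))

  score-suc : ∀ v → score x′ (suc v) ≡ suc (score x v)
  score-suc v = sum-cong-≗ (λ u → cong ⟦_⟧ (arc′ (suc v) u))

  antitone : ∀ a b → arc x′ a b ≡ true → score x′ b ≤ score x′ a
  antitone a       zero    _   = subst (_≤ score x′ a) (sym score-sink) z≤n
  antitone zero    (suc b) a→b with () ← trans (sym a→b) (arc′ zero (suc b))
  antitone (suc a) (suc b) a→b = subst₂ _≤_ (sym (score-suc b)) (sym (score-suc a))
                                        (s≤s (score-antitone a b (trans (sym (arc′ (suc a) (suc b))) a→b)))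

  inDegree-≥′ : ∀ v → m ≤ inDegree x′ v
  inDegree-≥′ zero    = subst (m ≤_) inDegree-sink m≤n
    where
    inDegree-sink : n ≡ inDegree x′ zero
    inDegree-sink = sym (suc-injective (trans (cong (λ s → suc (s + inDegree x′ zero)) (sym score-sink))
                                              (score+inDegree x′ zero)))
  inDegree-≥′ (suc v) = subst (m ≤_) (sym (sum-cong-≗ (λ u → cong ⟦_⟧ (arc′ u (suc v))))) (inDegree-≥ v)

parity : ∀ n → ∃[ m ] (suc n ≡ 1+2* m ⊎ suc n ≡ suc (1+2* m))
parity zero          = 0 , inj₁ refl
parity (suc zero)    = 0 , inj₂ refl
parity (suc (suc n)) with parity n
... | m , inj₁ odd  = suc m , inj₁ (cong (2 +_) odd)
... | m , inj₂ even = suc m , inj₂ (cong (2 +_) even)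

1+2*m<4*m : ∀ m → 1 ≤ m → 1+2* m < 4 * m
1+2*m<4*m (suc zero)    _ = ≤-refl
1+2*m<4*m (suc (suc m)) _ = begin-strict
  2 + 1+2* suc m   <⟨ +-monoʳ-< 2 (1+2*m<4*m (suc m) (s≤s z≤n)) ⟩
  2 + 4 * suc m    ≤⟨ +-monoˡ-≤ (4 * suc m) (m≤m+n 2 2) ⟩
  4 + 4 * suc m    ≡⟨ *-suc 4 (suc m) ⟨
  4 * suc (suc m)  ∎
  where open ≤-Reasoning

hardInstance : ∀ n → 3 ≤ n → ∃[ m ] (n ≤ 4 * m × HardInstance n m)
hardInstance (suc n) 3≤n with parity n
... | zero  , inj₁ refl = ⊥-elim (≤⇒≯ 3≤n (s≤s (s≤s z≤n)))
... | zero  , inj₂ refl = ⊥-elim (≤⇒≯ 3≤n (s≤s (s≤s (s≤s z≤n))))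
... | suc m , inj₁ refl = suc m , <⇒≤ (1+2*m<4*m (suc m) (s≤s z≤n)) , regularInstance (suc m)
... | suc m , inj₂ refl =
  suc m , 1+2*m<4*m (suc m) (s≤s z≤n) , sinkInstance (m≤1+2*m (suc m)) (regularInstance (suc m))

n≤4m∧m²≤2d⇒n²≤32d : ∀ {n} m d → n ≤ 4 * m → m * m ≤ 2 * d → n * n ≤ 32 * d
n≤4m∧m²≤2d⇒n²≤32d {n} m d n≤4m m²≤2d = begin
  n * n              ≤⟨ *-mono-≤ n≤4m n≤4m ⟩
  (4 * m) * (4 * m)  ≡⟨ 4m*4m m ⟩
  16 * (m * m)       ≤⟨ *-monoʳ-≤ 16 m²≤2d ⟩
  16 * (2 * d)       ≡⟨ *-assoc 16 2 d ⟨
  32 * d             ∎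
  where
  open ≤-Reasoning
  4m*4m : ∀ m → (4 * m) * (4 * m) ≡ 16 * (m * m)
  4m*4m = solve-∀

lowerBound : ∀ n → 3 ≤ n → (t : DTree n) → SolvesStrongKing t → n * n ≤ 32 * depth t
lowerBound n 3≤n t solves with hardInstance n 3≤n
... | m , n≤4m , H = n≤4m∧m²≤2d⇒n²≤32d m (depth t) n≤4m (depth-lowerBound H t solves)

corollary4p7 : ∃[ c ] ∃[ C ] ∃[ N ]
    (((n : ℕ) → N ≤ n → (t : DTree n) → SolvesStrongKing t → n * n ≤ c * depth t)
    × ((n : ℕ) → N ≤ n → ∃[ t ] (SolvesStrongKing {n} t × depth t ≤ C * (n * n))))
corollary4p7 = 32 , 1 , 3 , lowerBound , upper
  where
  upper : ∀ n → 3 ≤ n → ∃[ t ] (SolvesStrongKing {n} t × depth t ≤ 1 * (n * n))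
  upper n 3≤n with upperBound n (≤-trans (s≤s z≤n) 3≤n)
  ... | t , solves , depth≤ = t , solves , subst (depth t ≤_) (sym (*-identityˡ (n * n))) depth≤
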